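{- For $n\in\mathbb{Z}$ define integers $G_n,F_n$ by $(1+\sqrt{2})^n=G_n+F_n\sqrt{2}$. Fix an odd prime $p$. Then there is at most one pair $(n,r)$ of positive integers with $r\ge 2$ such that $G_n=p^r$. -}

module Defs where

open import Data.Nat using (ℕ; zero; suc; _+_; _*_)
open import Data.Product using (_×_; _,_; proj₁; proj₂)

-- (1 + √2)^n = G n + F n √2, computed by repeated multiplication by (1 + √2):
-- (a + b√2)(1 + √2) = (a + 2b) + (a + b)√2.  For n ≥ 0 both are natural numbers.
GF : ℕ → ℕ × ℕ
GF zero = 1 , 0
GF (suc n) = let (a , b) = GF n in (a + 2 * b) , (a + b)

G : ℕ → ℕ
G n = proj₁ (GF n)

F : ℕ → ℕ
F n = proj₂ (GF n)

module Submission where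

-- G n ∣ G m with n ≥ 2 forces m = n (1 + 2 j).  Expanding (1 + √2) ^ (n (1 + 2 j)) modulo G n ^ 3, using the
-- Pell equation 2 F² = G² ± 1, gives G (n (1 + 2 j)) ≡ ± (1 + 2 j) G n (mod G n ^ 3).  So if G n = p ^ r and
-- G m = p ^ s with n < m, then m = n (1 + 2 j) with j ≥ 1, and G m > G n ^ 3 makes p ^ (2 r) divide 1 + 2 j.
-- Hence m is also an odd multiple of n p, so G (n p) ∣ G m is a power of p; the same congruence for
-- n p = n (1 + 2 i) then makes p ^ (2 r) divide p, which is absurd.

open import Defs
open import Data.Nat using (ℕ; zero; suc; _∸_; _^_; _≤_; _<_; _≤′_; ≤′-refl; ≤′-step; z≤n; s≤s; NonZero; >-nonZero)
open import Data.Nat.Primality using (Prime)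
open import Data.Nat.Divisibility using (_∣_; ∣1⇒≡1)
open import Data.Nat.Coprimality using (Coprime)
open import Data.Product using (_×_; _,_; proj₁; proj₂; ∃-syntax)
open import Relation.Nullary using (¬_)
open import Relation.Binary.PropositionalEquality

module _ where
  open import Data.Nat using (_+_; _*_)
  open import Data.Nat.Properties
  open import Data.Nat.Tactic.RingSolver using (solve-∀)

  GF-+ : ∀ m n → GF (m + n) ≡ (G m * G n + 2 * (F m * F n) , G m * F n + F m * G n)
  GF-+ zero    n = sym (cong₂ _,_ (G-base (G n) (F n)) (F-base (G n) (F n)))
    where
    G-base : ∀ c d → 1 * c + 2 * (0 * d) ≡ c
    G-base = solve-∀
    F-base : ∀ c d → 1 * d + 0 * c ≡ d
    F-base = solve-∀
  GF-+ (suc m) n rewrite GF-+ m n = cong₂ _,_ (G-step (G m) (F m) (G n) (F n)) (F-step (G m) (F m) (G n) (F n))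
    where
    G-step : ∀ a b c d → a * c + 2 * (b * d) + 2 * (a * d + b * c) ≡ (a + 2 * b) * c + 2 * ((a + b) * d)
    G-step = solve-∀
    F-step : ∀ a b c d → a * c + 2 * (b * d) + (a * d + b * c) ≡ (a + 2 * b) * d + (a + b) * c
    F-step = solve-∀

  G-+ : ∀ m n → G (m + n) ≡ G m * G n + 2 * (F m * F n)
  G-+ m n = cong proj₁ (GF-+ m n)

  F-+ : ∀ m n → F (m + n) ≡ G m * F n + F m * G n
  F-+ m n = cong proj₂ (GF-+ m n)

  G>0 : ∀ n → 0 < G n
  G>0 zero    = s≤s z≤n
  G>0 (suc n) = ≤-trans (G>0 n) (m≤m+n (G n) (2 * F n))

  G-nonZero : ∀ n → NonZero (G n)
  G-nonZero n = >-nonZero (G>0 n)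

  F[suc]>0 : ∀ n → 0 < F (suc n)
  F[suc]>0 n = ≤-trans (G>0 n) (m≤m+n (G n) (F n))

  F≤G : ∀ n → F n ≤ G n
  F≤G zero    = z≤n
  F≤G (suc n) = +-monoʳ-≤ (G n) (m≤m+n (F n) (F n + 0))

  G-mono-≤ : ∀ {m n} → m ≤ n → G m ≤ G n
  G-mono-≤ m≤n = go (≤⇒≤′ m≤n)
    where
    go : ∀ {m n} → m ≤′ n → G m ≤ G n
    go ≤′-refl      = ≤-refl
    go (≤′-step le) = ≤-trans (go le) (m≤m+n _ _)

  G<G[suc] : ∀ {n} → 1 ≤ n → G n < G (suc n)
  G<G[suc] {suc n} _ = m<m+n (G (suc n)) (≤-trans (F[suc]>0 n) (m≤m+n _ _))

  G-mono-< : ∀ {m n} → 1 ≤ m → m < n → G m < G n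
  G-mono-< 1≤m m<n = <-≤-trans (G<G[suc] 1≤m) (G-mono-≤ m<n)

module _ where
  open import Data.Integer using (ℤ; +_; -_; _+_; _-_; _*_; ∣_∣; 0ℤ; 1ℤ; -1ℤ)
  open import Data.Integer.Properties using (pos-*; abs-*; *-comm; *-assoc; *-identityʳ)
  open import Data.Integer.Divisibility using (*-cancelˡ-∣)
  open import Data.Integer.Divisibility.Signed as Signed using (∣ᵤ⇒∣; ∣⇒∣ᵤ)
  open import Data.Integer.Tactic.RingSolver using (solve-∀)
  import Data.Nat as ℕ
  import Data.Nat.Properties as ℕₚ
  import Data.Nat.Tactic.RingSolver as ℕ-Solver

  x*u*u≡x : ∀ x u → u * u ≡ 1ℤ → x * u * u ≡ x
  x*u*u≡x x u u²≡1 = trans (*-assoc x u u) (trans (cong (x *_) u²≡1) (*-identityʳ x))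

  pos-G-+ : ∀ m n → + G (m ℕ.+ n) ≡ + G m * + G n + + 2 * (+ F m * + F n)
  pos-G-+ m n = trans (cong +_ (G-+ m n))
    (cong₂ _+_ (pos-* (G m) (G n)) (trans (pos-* 2 (F m ℕ.* F n)) (cong (+ 2 *_) (pos-* (F m) (F n)))))

  pos-F-+ : ∀ m n → + F (m ℕ.+ n) ≡ + G m * + F n + + F m * + G n
  pos-F-+ m n = trans (cong +_ (F-+ m n)) (cong₂ _+_ (pos-* (G m) (F n)) (pos-* (F m) (G n)))

  pell : ∀ n → ∃[ s ] s * s ≡ 1ℤ × + 2 * (+ F n * + F n) ≡ + G n * + G n + s
  pell zero = -1ℤ , refl , refl
  pell (suc n) with pell n
  ... | s , s²≡1 , pell-n = - s , trans (neg-square s) s²≡1 , step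
    where
    x = + G n
    y = + F n
    neg-square : ∀ s → - s * - s ≡ s * s
    neg-square = solve-∀
    expand : ∀ x y → + 2 * ((x + y) * (x + y)) ≡ (x + + 2 * y) * (x + + 2 * y) + (x * x - + 2 * (y * y))
    expand = solve-∀
    collapse : ∀ x y s → (x + + 2 * y) * (x + + 2 * y) + (x * x - (x * x + s)) ≡ (x + + 2 * y) * (x + + 2 * y) + - s
    collapse = solve-∀
    step : + 2 * (+ F (suc n) * + F (suc n)) ≡ + G (suc n) * + G (suc n) + - s
    step = begin
      + 2 * ((x + y) * (x + y))
        ≡⟨ expand x y ⟩
      (x + + 2 * y) * (x + + 2 * y) + (x * x - + 2 * (y * y))
        ≡⟨ cong (λ w → (x + + 2 * y) * (x + + 2 * y) + (x * x - w)) pell-n ⟩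
      (x + + 2 * y) * (x + + 2 * y) + (x * x - (x * x + s))
        ≡⟨ collapse x y s ⟩
      (x + + 2 * y) * (x + + 2 * y) + - s
        ≡⟨ cong (λ w → (x + w) * (x + w) + - s) (sym (pos-* 2 (F n))) ⟩
      + G (suc n) * + G (suc n) + - s  ∎
      where open ≡-Reasoning

  module _ (d : ℕ) where
    private
      x = + G d
      y = + F d
      s = proj₁ (pell d)
      s²≡1 = proj₁ (proj₂ (pell d))
      2y²≡x²+s = proj₂ (proj₂ (pell d))

    pos-G-double : + G (d ℕ.+ d) ≡ + 2 * (x * x) + s
    pos-G-double = begin
      + G (d ℕ.+ d)          ≡⟨ pos-G-+ d d ⟩
      x * x + + 2 * (y * y)  ≡⟨ cong (λ w → x * x + w) 2y²≡x²+s ⟩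
      x * x + (x * x + s)    ≡⟨ double x s ⟩
      + 2 * (x * x) + s      ∎
      where
      open ≡-Reasoning
      double : ∀ x s → x * x + (x * x + s) ≡ + 2 * (x * x) + s
      double = solve-∀

    Expansion : ℕ → ℤ → Set
    Expansion k K = ∃[ t ] ∃[ u ] ∃[ v ] t * t ≡ 1ℤ
      × + G k ≡ K * x * t + x * x * x * u
      × + F k ≡ t * y + x * x * v

    expansion-base : Expansion d 1ℤ
    expansion-base = 1ℤ , 0ℤ , 0ℤ , refl , G-base x , F-base x y
      where
      G-base : ∀ x → x ≡ 1ℤ * x * 1ℤ + x * x * x * 0ℤ
      G-base = solve-∀
      F-base : ∀ x y → y ≡ 1ℤ * y + x * x * 0ℤ
      F-base = solve-∀

    -- Multiplying by (1 + √2) ^ (2 d) = (2 x² + s) + 2 x y √2 with 2 y² = x² + s.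
    expansion-step : ∀ {k K} → Expansion k K → Expansion (d ℕ.+ d ℕ.+ k) (K + + 2)
    expansion-step {k} {K} (t , u , v , t²≡1 , G-eq , F-eq) =
      s * t , U , V , square-product s t s²≡1 t²≡1 , G-step , F-step
      where
      U = + 2 * K * t + + 2 * x * x * u + s * u + + 4 * y * v + + 2 * t
      V = + 2 * t * y + + 2 * x * x * v + s * v + + 2 * K * y * t + + 2 * x * x * y * u
      square-product : ∀ a b → a * a ≡ 1ℤ → b * b ≡ 1ℤ → (a * b) * (a * b) ≡ 1ℤ
      square-product a b a²≡1 b²≡1 = trans (interchange a b) (cong₂ _*_ a²≡1 b²≡1)
        where
        interchange : ∀ a b → (a * b) * (a * b) ≡ (a * a) * (b * b)
        interchange = solve-∀
      A = s * K * x * t + x * x * x * (+ 2 * K * t + + 2 * x * x * u + s * u + + 4 * y * v)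
      G-step : + G (d ℕ.+ d ℕ.+ k) ≡ (K + + 2) * x * (s * t) + x * x * x * U
      G-step = begin
        + G (d ℕ.+ d ℕ.+ k)
          ≡⟨ pos-G-+ (d ℕ.+ d) k ⟩
        + G (d ℕ.+ d) * + G k + + 2 * (+ F (d ℕ.+ d) * + F k)
          ≡⟨ cong₂ (λ a b → a * + G k + + 2 * (b * + F k)) pos-G-double (pos-F-+ d d) ⟩
        (+ 2 * (x * x) + s) * + G k + + 2 * ((x * y + y * x) * + F k)
          ≡⟨ cong₂ (λ a b → (+ 2 * (x * x) + s) * a + + 2 * ((x * y + y * x) * b)) G-eq F-eq ⟩
        (+ 2 * (x * x) + s) * (K * x * t + x * x * x * u) + + 2 * ((x * y + y * x) * (t * y + x * x * v))
          ≡⟨ isolate-2y² x y s t u v K ⟩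
        A + + 2 * x * t * (+ 2 * (y * y))
          ≡⟨ cong (λ w → A + + 2 * x * t * w) 2y²≡x²+s ⟩
        A + + 2 * x * t * (x * x + s)
          ≡⟨ regroup x y s t u v K ⟩
        (K + + 2) * x * (s * t) + x * x * x * U  ∎
        where
        open ≡-Reasoning
        isolate-2y² : ∀ x y s t u v K →
          (+ 2 * (x * x) + s) * (K * x * t + x * x * x * u) + + 2 * ((x * y + y * x) * (t * y + x * x * v))
          ≡ s * K * x * t + x * x * x * (+ 2 * K * t + + 2 * x * x * u + s * u + + 4 * y * v)
            + + 2 * x * t * (+ 2 * (y * y))
        isolate-2y² = solve-∀
        regroup : ∀ x y s t u v K →
          s * K * x * t + x * x * x * (+ 2 * K * t + + 2 * x * x * u + s * u + + 4 * y * v) + + 2 * x * t * (x * x + s)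
          ≡ (K + + 2) * x * (s * t) + x * x * x * (+ 2 * K * t + + 2 * x * x * u + s * u + + 4 * y * v + + 2 * t)
        regroup = solve-∀
      F-step : + F (d ℕ.+ d ℕ.+ k) ≡ (s * t) * y + x * x * V
      F-step = begin
        + F (d ℕ.+ d ℕ.+ k)
          ≡⟨ pos-F-+ (d ℕ.+ d) k ⟩
        + G (d ℕ.+ d) * + F k + + F (d ℕ.+ d) * + G k
          ≡⟨ cong₂ (λ a b → a * + F k + b * + G k) pos-G-double (pos-F-+ d d) ⟩
        (+ 2 * (x * x) + s) * + F k + (x * y + y * x) * + G k
          ≡⟨ cong₂ (λ a b → (+ 2 * (x * x) + s) * b + (x * y + y * x) * a) G-eq F-eq ⟩
        (+ 2 * (x * x) + s) * (t * y + x * x * v) + (x * y + y * x) * (K * x * t + x * x * x * u)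
          ≡⟨ regroup x y s t u v K ⟩
        (s * t) * y + x * x * V  ∎
        where
        open ≡-Reasoning
        regroup : ∀ x y s t u v K →
          (+ 2 * (x * x) + s) * (t * y + x * x * v) + (x * y + y * x) * (K * x * t + x * x * x * u)
          ≡ (s * t) * y + x * x * (+ 2 * t * y + + 2 * x * x * v + s * v + + 2 * K * y * t + + 2 * x * x * y * u)
        regroup = solve-∀

    expansion : ∀ i → Expansion (d ℕ.* (1 ℕ.+ 2 ℕ.* i)) (+ (1 ℕ.+ 2 ℕ.* i))
    expansion zero    = subst (λ k → Expansion k 1ℤ) (sym (ℕₚ.*-identityʳ d)) expansion-base
    expansion (suc i) = subst₂ Expansion (next-index d i) (cong +_ (next-multiplier i))
      (expansion-step {d ℕ.* (1 ℕ.+ 2 ℕ.* i)} {+ (1 ℕ.+ 2 ℕ.* i)} (expansion i))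
      where
      next-index : ∀ d i → d ℕ.+ d ℕ.+ d ℕ.* (1 ℕ.+ 2 ℕ.* i) ≡ d ℕ.* (1 ℕ.+ 2 ℕ.* suc i)
      next-index = ℕ-Solver.solve-∀
      next-multiplier : ∀ i → 1 ℕ.+ 2 ℕ.* i ℕ.+ 2 ≡ 1 ℕ.+ 2 ℕ.* suc i
      next-multiplier = ℕ-Solver.solve-∀

  -- On images + m and + n, the unsigned divisibility produced by ∣⇒∣ᵤ is m ∣ n in ℕ by definition.
  G∣G[odd-multiple] : ∀ d i → G d ∣ G (d ℕ.* (1 ℕ.+ 2 ℕ.* i))
  G∣G[odd-multiple] d i with expansion d i
  ... | t , u , _ , _ , G-eq , _ = ∣⇒∣ᵤ (subst (x Signed.∣_) (sym G-eq)
      (Signed.∣m∣n⇒∣m+n (Signed.∣m⇒∣m*n t (Signed.∣n⇒∣m*n K Signed.∣-refl))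
                        (Signed.∣m⇒∣m*n u (Signed.∣n⇒∣m*n (x * x) Signed.∣-refl))))
    where
    x = + G d
    K = + (1 ℕ.+ 2 ℕ.* i)

  G²∣multiplier : ∀ d i → G d ℕ.* G d ℕ.* G d ∣ G (d ℕ.* (1 ℕ.+ 2 ℕ.* i)) → G d ℕ.* G d ∣ 1 ℕ.+ 2 ℕ.* i
  G²∣multiplier d i G³∣ with expansion d i
  ... | t , u , _ , t²≡1 , G-eq , _ =
    subst (_∣ 1 ℕ.+ 2 ℕ.* i) (abs-* x x) (*-cancelˡ-∣ x {{G-nonZero d}} (∣⇒∣ᵤ x³∣xK))
    where
    x = + G d
    K = + (1 ℕ.+ 2 ℕ.* i)
    x³∣G : x * x * x Signed.∣ K * x * t + x * x * x * u
    x³∣G = subst₂ Signed._∣_ (trans (pos-* (G d ℕ.* G d) (G d)) (cong (_* x) (pos-* (G d) (G d)))) G-eq (∣ᵤ⇒∣ G³∣)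
    x³∣Kxt : x * x * x Signed.∣ K * x * t
    x³∣Kxt = Signed.∣m+n∣n⇒∣m x³∣G (Signed.∣m⇒∣m*n u Signed.∣-refl)
    x³∣xK : x * (x * x) Signed.∣ x * K
    x³∣xK = subst₂ Signed._∣_ (reassoc x) (trans (x*u*u≡x (K * x) t t²≡1) (*-comm K x)) (Signed.∣m⇒∣m*n t x³∣Kxt)
      where
      reassoc : ∀ x → x * x * x ≡ x * (x * x)
      reassoc = solve-∀

  coprime-G-2F : ∀ n → Coprime (G n) (2 ℕ.* F n)
  coprime-G-2F n {e} (e∣G , e∣2F) with pell n
  ... | s , s²≡1 , 2y²≡x²+s = ∣1⇒≡1 (subst (e ∣_) ∣s∣≡1 (∣⇒∣ᵤ e∣s))
    where
    x = + G n
    y = + F n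
    e∣2y² : + e Signed.∣ + 2 * (y * y)
    e∣2y² = subst (+ e Signed.∣_) (trans (cong (_* y) (pos-* 2 (F n))) (*-assoc (+ 2) y y))
      (Signed.∣m⇒∣m*n {m = + (2 ℕ.* F n)} y (∣ᵤ⇒∣ e∣2F))
    2y²-x²≡s : + 2 * (y * y) - x * x ≡ s
    2y²-x²≡s = trans (cong (_- x * x) 2y²≡x²+s) (cancel x s)
      where
      cancel : ∀ x s → x * x + s - x * x ≡ s
      cancel = solve-∀
    e∣s : + e Signed.∣ s
    e∣s = subst (+ e Signed.∣_) 2y²-x²≡s (Signed.∣m∣n⇒∣m-n e∣2y² (Signed.∣m⇒∣m*n {m = x} x (∣ᵤ⇒∣ e∣G)))
    ∣s∣≡1 : ∣ s ∣ ≡ 1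
    ∣s∣≡1 = ℕₚ.m*n≡1⇒m≡1 ∣ s ∣ ∣ s ∣ (trans (sym (abs-* s s)) (cong ∣_∣ s²≡1))

open import Data.Nat using (_+_; _*_; nonTrivial⇒n>1)
open import Data.Nat.Properties
open import Data.Nat.Divisibility
open import Data.Nat.Primality using (prime⇒irreducible; prime⇒nonZero; prime⇒nonTrivial)
open import Data.Nat.Coprimality using (coprime-divisor)
open import Relation.Binary.Definitions using (tri<; tri≈; tri>)
open import Relation.Nullary using (yes; no)
open import Data.Nat.Induction using (<-rec)
open import Data.Nat.Tactic.RingSolver using (solve-∀)
open import Data.Sum using (inj₁; inj₂)
open import Data.Empty using (⊥-elim)

coprime-G-F : ∀ n → Coprime (G n) (F n)
coprime-G-F n (d∣G , d∣F) = coprime-G-2F n (d∣G , ∣n⇒∣m*n 2 d∣F)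

G∣G[n+k]⇒G∣F : ∀ n k → G n ∣ G (n + k) → G n ∣ F k
G∣G[n+k]⇒G∣F n k Gn∣ = coprime-divisor (coprime-G-2F n)
  (subst (G n ∣_) (sym (*-assoc 2 (F n) (F k)))
    (∣m+n∣m⇒∣n (subst (G n ∣_) (G-+ n k) Gn∣) (m∣m*n (G k))))

G∣F[n+k]⇒G∣G : ∀ n k → G n ∣ F (n + k) → G n ∣ G k
G∣F[n+k]⇒G∣G n k Gn∣ = coprime-divisor (coprime-G-F n)
  (∣m+n∣m⇒∣n (subst (G n ∣_) (F-+ n k) Gn∣) (m∣m*n (F k)))

G∤G : ∀ {m n} → 2 ≤ n → m < n → ¬ G n ∣ G m
G∤G {zero}  2≤n _   Gn∣ = <⇒≱ (G-mono-< ≤-refl 2≤n) (∣⇒≤ Gn∣)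
G∤G {suc m} 2≤n m<n Gn∣ = <⇒≱ (G-mono-< (s≤s z≤n) m<n) (∣⇒≤ {{G-nonZero (suc m)}} Gn∣)

G∤F : ∀ {k n} → 2 ≤ n → 0 < k → k ≤ n → ¬ G n ∣ F k
G∤F {suc k} {n} 2≤n 0<k k≤n Gn∣ with m≤n⇒m<n∨m≡n k≤n
... | inj₁ k<n = <⇒≱ (≤-<-trans (F≤G (suc k)) (G-mono-< 0<k k<n)) (∣⇒≤ {{>-nonZero (F[suc]>0 k)}} Gn∣)
... | inj₂ refl = <⇒≱ (G-mono-< ≤-refl 2≤n) (≤-reflexive (coprime-G-F n (∣-refl , Gn∣)))

G∣G[n+k]⇒n<k : ∀ {n k} → 2 ≤ n → 0 < k → G n ∣ G (n + k) → n < k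
G∣G[n+k]⇒n<k {n} {k} 2≤n 0<k Gn∣ = ≰⇒> (λ k≤n → G∤F 2≤n 0<k k≤n (G∣G[n+k]⇒G∣F n k Gn∣))

-- Divisibility by G n has period 2 n: G n ∣ G (n + (n + l)) gives G n ∣ F (n + l) and then G n ∣ G l.
G∣G⇒odd-multiple : ∀ {n} → 2 ≤ n → ∀ m → G n ∣ G m → ∃[ j ] m ≡ n * (1 + 2 * j)
G∣G⇒odd-multiple {n} 2≤n = <-rec (λ m → G n ∣ G m → ∃[ j ] m ≡ n * (1 + 2 * j)) step
  where
  step : ∀ m → (∀ {l} → l < m → G n ∣ G l → ∃[ j ] l ≡ n * (1 + 2 * j)) →
         G n ∣ G m → ∃[ j ] m ≡ n * (1 + 2 * j)
  step m rec Gn∣Gm with <-cmp m n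
  ... | tri< m<n _ _ = ⊥-elim (G∤G 2≤n m<n Gn∣Gm)
  ... | tri≈ _ refl _ = 0 , sym (*-identityʳ n)
  ... | tri> _ _ n<m = suc j , trans m≡n+[n+l] (trans (cong (λ i → n + (n + i)) l≡n[1+2j]) (two-more n j))
    where
    k = m ∸ n
    m≡n+k : m ≡ n + k
    m≡n+k = sym (m+[n∸m]≡n (<⇒≤ n<m))
    n<k : n < k
    n<k = G∣G[n+k]⇒n<k 2≤n (m<n⇒0<n∸m n<m) (subst (λ i → G n ∣ G i) m≡n+k Gn∣Gm)
    l = k ∸ n
    m≡n+[n+l] : m ≡ n + (n + l)
    m≡n+[n+l] = trans m≡n+k (cong (n +_) (sym (m+[n∸m]≡n (<⇒≤ n<k))))
    Gn∣Gl : G n ∣ G l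
    Gn∣Gl = G∣F[n+k]⇒G∣G n l (G∣G[n+k]⇒G∣F n (n + l) (subst (λ i → G n ∣ G i) m≡n+[n+l] Gn∣Gm))
    l<m : l < m
    l<m = subst (l <_) (sym m≡n+[n+l]) (<-≤-trans (m<n+m l (≤-trans (s≤s z≤n) 2≤n)) (m≤n+m (n + l) n))
    j = proj₁ (rec l<m Gn∣Gl)
    l≡n[1+2j] = proj₂ (rec l<m Gn∣Gl)
    two-more : ∀ n j → n + (n + n * (1 + 2 * j)) ≡ n * (1 + 2 * suc j)
    two-more = solve-∀

G³<G[odd-multiple] : ∀ {n j} → 0 < n → 0 < j → G n * G n * G n < G (n * (1 + 2 * j))
G³<G[odd-multiple] {suc n′} {j} 0<n 0<j = begin-strict
  x * x * x                             ≡⟨ *-assoc x x x ⟩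
  x * (x * x)                           <⟨ *-monoʳ-< x {{G-nonZero n}} x²<G[2n] ⟩
  x * G (n + n)                         ≤⟨ m≤m+n (x * G (n + n)) _ ⟩
  x * G (n + n) + 2 * (F n * F (n + n)) ≡⟨ G-+ n (n + n) ⟨
  G (n + (n + n))                       ≤⟨ G-mono-≤ 3n≤n[1+2j] ⟩
  G (n * (1 + 2 * j))                   ∎
  where
  open ≤-Reasoning
  n = suc n′
  x = G n
  y = F n
  x²<G[2n] : x * x < G (n + n)
  x²<G[2n] = subst (x * x <_) (sym (G-+ n n))
    (m<m+n (x * x) {2 * (y * y)} (*-mono-≤ {x = 1} {2} {1} {y * y} (s≤s z≤n) (*-mono-≤ (F[suc]>0 n′) (F[suc]>0 n′))))
  3n≤n[1+2j] : n + (n + n) ≤ n * (1 + 2 * j)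
  3n≤n[1+2j] = subst (_≤ n * (1 + 2 * j)) (triple n) (*-monoʳ-≤ n (s≤s (*-monoʳ-≤ 2 0<j)))
    where
    triple : ∀ n → n * (1 + 2 * 1) ≡ n + (n + n)
    triple = solve-∀

^-monoʳ-∣ : ∀ p {m n} → m ≤ n → p ^ m ∣ p ^ n
^-monoʳ-∣ p {m} {n} m≤n = subst (p ^ m ∣_)
  (trans (sym (^-distribˡ-+-* p m (n ∸ m))) (cong (p ^_) (m+[n∸m]≡n m≤n)))
  (m∣m*n (p ^ (n ∸ m)))

^-cancelˡ-≤ : ∀ {p m n} → 1 < p → p ^ m ≤ p ^ n → m ≤ n
^-cancelˡ-≤ {p} 1<p p^m≤p^n = ≮⇒≥ (λ n<m → <⇒≱ (^-monoʳ-< p 1<p n<m) p^m≤p^n)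

^-injective : ∀ {p m n} → 1 < p → p ^ m ≡ p ^ n → m ≡ n
^-injective 1<p eq = ≤-antisym (^-cancelˡ-≤ 1<p (≤-reflexive eq)) (^-cancelˡ-≤ 1<p (≤-reflexive (sym eq)))

¬2∣1+2* : ∀ i → ¬ 2 ∣ 1 + 2 * i
¬2∣1+2* i 2∣ with ∣1⇒≡1 (∣m+n∣m⇒∣n (subst (2 ∣_) (+-comm 1 (2 * i)) 2∣) (m∣m*n i))
... | ()

odd⇒≡1+2* : ∀ {n} → ¬ 2 ∣ n → ∃[ i ] n ≡ 1 + 2 * i
odd⇒≡1+2* {zero}        ¬2∣n = ⊥-elim (¬2∣n (divides 0 refl))
odd⇒≡1+2* {suc zero}    _    = 0 , refl
odd⇒≡1+2* {suc (suc n)} ¬2∣n with odd⇒≡1+2* (λ 2∣n → ¬2∣n (∣m∣n⇒∣m+n (∣-refl {2}) 2∣n))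
... | i , refl = suc i , two-more i
  where
  two-more : ∀ i → 2 + (1 + 2 * i) ≡ 1 + 2 * suc i
  two-more = solve-∀

module _ {p : ℕ} (p-prime : Prime p) where

  ∣p^⇒≡p^ : ∀ {d} s → d ∣ p ^ s → ∃[ t ] d ≡ p ^ t
  ∣p^⇒≡p^ zero    d∣1 = 0 , ∣1⇒≡1 d∣1
  ∣p^⇒≡p^ {d} (suc s) d∣p^s+1 with p ∣? d
  ... | yes (divides q refl) with ∣p^⇒≡p^ {q} s (*-cancelʳ-∣ p {{prime⇒nonZero p-prime}} d∣p^s+1′)
    where
    d∣p^s+1′ : q * p ∣ p ^ s * p
    d∣p^s+1′ = subst (q * p ∣_) (*-comm p (p ^ s)) d∣p^s+1
  ...   | t , refl = suc t , *-comm (p ^ t) p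
  ∣p^⇒≡p^ {d} (suc s) d∣p^s+1 | no ¬p∣d = ∣p^⇒≡p^ s (coprime-divisor d⊥p d∣p^s+1)
    where
    d⊥p : Coprime d p
    d⊥p {e} (e∣d , e∣p) with prime⇒irreducible p-prime e∣p
    ... | inj₁ e≡1 = e≡1
    ... | inj₂ refl = ⊥-elim (¬p∣d e∣d)

module _ {p : ℕ} (p-prime : Prime p) (p-odd : ¬ 2 ∣ p) where

  private
    1<p : 1 < p
    1<p = nonTrivial⇒n>1 p {{prime⇒nonTrivial p-prime}}

  G≡p^⇒2≤n : ∀ {n r} → 0 < r → G n ≡ p ^ r → 2 ≤ n
  G≡p^⇒2≤n {0}           0<r G≡ = ⊥-elim (<-irrefl G≡ (^-monoʳ-< p 1<p 0<r))
  G≡p^⇒2≤n {1}           0<r G≡ = ⊥-elim (<-irrefl G≡ (^-monoʳ-< p 1<p 0<r))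
  G≡p^⇒2≤n {suc (suc n)} _   _  = s≤s (s≤s z≤n)

  p^r²∣multiplier : ∀ {n r j s} → 0 < n → 0 < j → G n ≡ p ^ r → G (n * (1 + 2 * j)) ≡ p ^ s →
                    p ^ r * p ^ r ∣ 1 + 2 * j
  p^r²∣multiplier {n} {r} {j} {s} 0<n 0<j Gn≡ Gm≡ =
    subst (λ x → x * x ∣ 1 + 2 * j) Gn≡ (G²∣multiplier n j G³∣Gm)
    where
    p^[3r]≡G³ : p ^ (r + r + r) ≡ G n * G n * G n
    p^[3r]≡G³ = trans (^-distribˡ-+-* p (r + r) r)
      (trans (cong (_* p ^ r) (^-distribˡ-+-* p r r)) (cong (λ x → x * x * x) (sym Gn≡)))
    3r≤s : r + r + r ≤ s
    3r≤s = ^-cancelˡ-≤ 1<p (subst₂ _≤_ (sym p^[3r]≡G³) Gm≡ (<⇒≤ (G³<G[odd-multiple] 0<n 0<j)))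
    G³∣Gm : G n * G n * G n ∣ G (n * (1 + 2 * j))
    G³∣Gm = subst₂ _∣_ p^[3r]≡G³ (sym Gm≡) (^-monoʳ-∣ p 3r≤s)

  ¬G[n*p]≡p^ : ∀ {n r} → 0 < r → G n ≡ p ^ r → ¬ (∃[ t ] G (n * p) ≡ p ^ t)
  ¬G[n*p]≡p^ {n} {r} 0<r Gn≡ (t , G[np]≡) with odd⇒≡1+2* p-odd
  ... | i , p≡1+2i = <⇒≱ p<p^r*p^r (∣⇒≤ {{prime⇒nonZero p-prime}} p^r²∣p)
    where
    p≤p^r : p ≤ p ^ r
    p≤p^r = subst (_≤ p ^ r) (*-identityʳ p) (^-monoʳ-≤ p {{prime⇒nonZero p-prime}} 0<r)
    p<p^r*p^r : p < p ^ r * p ^ r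
    p<p^r*p^r = <-≤-trans (m<m*n p p {{prime⇒nonZero p-prime}} 1<p) (*-mono-≤ p≤p^r p≤p^r)
    0<i : 0 < i
    0<i = n≢0⇒n>0 λ { refl → <-irrefl (sym p≡1+2i) 1<p }
    p^r²∣p : p ^ r * p ^ r ∣ p
    p^r²∣p = subst (p ^ r * p ^ r ∣_) (sym p≡1+2i)
      (p^r²∣multiplier {n} {r} {i} {t} (≤-trans (s≤s z≤n) (G≡p^⇒2≤n 0<r Gn≡)) 0<i Gn≡
        (subst (λ k → G (n * k) ≡ p ^ t) p≡1+2i G[np]≡))

  G≡p^⇒¬n<m : ∀ {n m r s} → 0 < r → G n ≡ p ^ r → G m ≡ p ^ s → ¬ n < m
  G≡p^⇒¬n<m {n} {m} {r} {s} 0<r Gn≡ Gm≡ n<m = ¬G[n*p]≡p^ {n} {r} 0<r Gn≡ G[n*p]≡p^t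
    where
    2≤n : 2 ≤ n
    2≤n = G≡p^⇒2≤n 0<r Gn≡
    Gn∣Gm : G n ∣ G m
    Gn∣Gm = subst₂ _∣_ (sym Gn≡) (sym Gm≡)
      (^-monoʳ-∣ p (^-cancelˡ-≤ {m = r} {n = s} 1<p (subst₂ _≤_ Gn≡ Gm≡ (G-mono-≤ (<⇒≤ n<m)))))
    j = proj₁ (G∣G⇒odd-multiple 2≤n m Gn∣Gm)
    m≡n[1+2j] = proj₂ (G∣G⇒odd-multiple 2≤n m Gn∣Gm)
    0<j : 0 < j
    0<j = n≢0⇒n>0 λ j≡0 → <-irrefl
      (sym (trans m≡n[1+2j] (trans (cong (λ k → n * (1 + 2 * k)) j≡0) (*-identityʳ n)))) n<m
    p∣1+2j : p ∣ 1 + 2 * j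
    p∣1+2j = ∣-trans (subst (p ∣_) (cong (p ^_) (m+[n∸m]≡n 0<r)) (m∣m*n (p ^ (r ∸ 1))))
      (∣-trans (m∣m*n (p ^ r))
        (p^r²∣multiplier {n} {r} {j} {s} (≤-trans (s≤s z≤n) 2≤n) 0<j Gn≡ (subst (λ k → G k ≡ p ^ s) m≡n[1+2j] Gm≡)))
    b = quotient p∣1+2j
    1+2j≡b*p : 1 + 2 * j ≡ b * p
    1+2j≡b*p = m∣n⇒n≡quotient*m p∣1+2j
    b-odd : ¬ 2 ∣ b
    b-odd 2∣b = ¬2∣1+2* j (subst (2 ∣_) (sym 1+2j≡b*p) (∣m⇒∣m*n p 2∣b))
    i = proj₁ (odd⇒≡1+2* b-odd)
    b≡1+2i = proj₂ (odd⇒≡1+2* b-odd)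
    m≡np[1+2i] : m ≡ n * p * (1 + 2 * i)
    m≡np[1+2i] = begin
      m                        ≡⟨ m≡n[1+2j] ⟩
      n * (1 + 2 * j)          ≡⟨ cong (n *_) 1+2j≡b*p ⟩
      n * (b * p)              ≡⟨ cong (λ c → n * (c * p)) b≡1+2i ⟩
      n * ((1 + 2 * i) * p)    ≡⟨ reassoc n (1 + 2 * i) p ⟩
      n * p * (1 + 2 * i)      ∎
      where
      open ≡-Reasoning
      reassoc : ∀ a b c → a * (b * c) ≡ a * c * b
      reassoc = solve-∀
    G[n*p]≡p^t : ∃[ t ] G (n * p) ≡ p ^ t
    G[n*p]≡p^t = ∣p^⇒≡p^ p-prime {G (n * p)} s
      (subst (G (n * p) ∣_) (trans (cong G (sym m≡np[1+2i])) Gm≡) (G∣G[odd-multiple] (n * p) i))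

  G≡p^-unique : ∀ {n r n′ r′} → 0 < r → G n ≡ p ^ r → 0 < r′ → G n′ ≡ p ^ r′ → n ≡ n′ × r ≡ r′
  G≡p^-unique {n} {r} {n′} {r′} 0<r Gn≡ 0<r′ Gn′≡ with <-cmp n n′
  ... | tri< n<n′ _ _ = ⊥-elim (G≡p^⇒¬n<m {r = r} {s = r′} 0<r Gn≡ Gn′≡ n<n′)
  ... | tri> _ _ n′<n = ⊥-elim (G≡p^⇒¬n<m {r = r′} {s = r} 0<r′ Gn′≡ Gn≡ n′<n)
  ... | tri≈ _ refl _ = refl , ^-injective 1<p (trans (sym Gn≡) Gn′≡)

lemma5p3 : (p : ℕ) → Prime p → ¬ (2 ∣ p) →
    (n r n′ r′ : ℕ) →
    1 ≤ n → 2 ≤ r → G n ≡ p ^ r →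
    1 ≤ n′ → 2 ≤ r′ → G n′ ≡ p ^ r′ →
    n ≡ n′ × r ≡ r′
lemma5p3 p p-prime p-odd n r n′ r′ _ 2≤r Gn≡ _ 2≤r′ Gn′≡ =
  G≡p^-unique p-prime p-odd (≤-trans (s≤s z≤n) 2≤r) Gn≡ (≤-trans (s≤s z≤n) 2≤r′) Gn′≡
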